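{- Let $\Lambda$ be a ring with identity and $A,B,C\in\Lambda$. Let $G=G(w)$ and $H=H(w)$. Then in $\Lambda[[z]]$: (1) $G=1+H+H^2+\cdots$; (2) $H=Bz+CGAz^2$.
   Context: A walk of length $l\ge0$ is an $(l+1)$-tuple $\alpha=(\alpha_0,\dots,\alpha_l)$ of integers with each $\alpha_i-\alpha_{i-1}\in\{ -1,0,1\}$; it is a walk from $\alpha_0$ to $\alpha_l$. Its weight is $w(\alpha)=1$ if $l=0$, and otherwise $w(\alpha)=U_1\cdots U_l$ with $U_i=A,B,C$ according as $\alpha_i-\alpha_{i-1}=-1,0,1$. A walk is standard if $\alpha_i\ge\alpha_l$ for all $i$; a walk is primitive if $l>0$, $\alpha_0=\alpha_l$ and no $\alpha_i$ with $0<i<l$ equals $\alpha_0$. $G(w)=\sum w(\alpha)z^{l(\alpha)}$ over all standard walks from $0$ to $0$, and $H(w)$ is the same sum over all primitive standard walks from $0$ to $0$. -}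

module Defs where

open import Level using (Level)
open import Algebra.Bundles using (Ring)
open import Data.Nat as ℕ using (ℕ; zero; suc; _∸_)
open import Data.Integer as ℤ using (ℤ; +_; -[1+_])
open import Data.Fin as Fin using (Fin; toℕ; fromℕ)
import Data.Fin.Properties as FinP
open import Data.Vec using (Vec; []; _∷_)
open import Data.List using (List; []; _∷_; [_]; map; concatMap; filter; foldr)
open import Data.Product using (_×_)
open import Relation.Binary.PropositionalEquality using (_≡_; _≢_)
open import Relation.Nullary using (Dec; ¬?)
open import Relation.Nullary.Decidable using (_×-dec_; _→-dec_)

data Step : Set where
  down stay up : Step

stepℤ : Step → ℤ
stepℤ down = -[1+ 0 ]
stepℤ stay = + 0
stepℤ up   = + 1

-- A walk of length l starting at 0 is given by its l steps.
-- pos ss i = α_i  (i = 0 .. l)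
pos : ∀ {l} → Vec Step l → Fin (suc l) → ℤ
pos ss       Fin.zero    = + 0
pos (s ∷ ss) (Fin.suc i) = stepℤ s ℤ.+ pos ss i

final : ∀ {l} → Vec Step l → ℤ
final {l} ss = pos ss (fromℕ l)

IsStandard00 : ∀ {l} → Vec Step l → Set
IsStandard00 {l} ss = (final ss ≡ + 0) × (∀ i → final ss ℤ.≤ pos ss i)

IsPrimStandard00 : ∀ {l} → Vec Step l → Set
IsPrimStandard00 {l} ss =
  IsStandard00 ss × (0 ℕ.< l) ×
  (∀ (i : Fin (suc l)) → 0 ℕ.< toℕ i → toℕ i ℕ.< l → pos ss i ≢ pos ss Fin.zero)

isStandard00? : ∀ {l} (ss : Vec Step l) → Dec (IsStandard00 ss)
isStandard00? ss = (final ss ℤ.≟ + 0) ×-dec FinP.all? (λ i → final ss ℤ.≤? pos ss i)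

isPrimStandard00? : ∀ {l} (ss : Vec Step l) → Dec (IsPrimStandard00 ss)
isPrimStandard00? {l} ss =
  isStandard00? ss ×-dec (0 ℕ.<? l) ×-dec
  FinP.all? (λ i → (0 ℕ.<? toℕ i) →-dec ((toℕ i ℕ.<? l) →-dec ¬? (pos ss i ℤ.≟ pos ss Fin.zero)))

allWalks : (l : ℕ) → List (Vec Step l)
allWalks zero    = [ [] ]
allWalks (suc l) = concatMap (λ s → map (s ∷_) (allWalks l)) (down ∷ stay ∷ up ∷ [])

module Series {c ℓ : Level} (R : Ring c ℓ) where
  open Ring R

  PowerSeries : Set c
  PowerSeries = ℕ → Carrier

  _≋_ : PowerSeries → PowerSeries → Set ℓ
  f ≋ g = ∀ n → f n ≈ g n

  sumL : List Carrier → Carrier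
  sumL = foldr _+_ 0#

  Σ≤ : ℕ → (ℕ → Carrier) → Carrier
  Σ≤ zero    f = f 0
  Σ≤ (suc n) f = Σ≤ n f + f (suc n)

  const : Carrier → PowerSeries
  const a zero    = a
  const a (suc n) = 0#

  one : PowerSeries
  one = const 1#

  Z : PowerSeries
  Z 1 = 1#
  Z _ = 0#

  _⊕_ : PowerSeries → PowerSeries → PowerSeries
  (f ⊕ g) n = f n + g n

  -- Cauchy product (noncommutative: order of factors kept)
  _⊛_ : PowerSeries → PowerSeries → PowerSeries
  (f ⊛ g) n = Σ≤ n (λ i → f i * g (n ∸ i))

  _^ˢ_ : PowerSeries → ℕ → PowerSeries
  f ^ˢ zero  = one
  f ^ˢ suc k = f ⊛ (f ^ˢ k)

  geomPartial : PowerSeries → ℕ → PowerSeries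
  geomPartial f N n = Σ≤ N (λ k → (f ^ˢ k) n)

  module Walks (A B C : Carrier) where
    U : Step → Carrier
    U down = A
    U stay = B
    U up   = C

    weight : ∀ {l} → Vec Step l → Carrier
    weight []            = 1#
    weight (s ∷ [])      = U s
    weight (s ∷ t ∷ ss)  = U s * weight (t ∷ ss)

    G : PowerSeries
    G l = sumL (map weight (filter isStandard00? (allWalks l)))

    H : PowerSeries
    H l = sumL (map weight (filter isPrimStandard00? (allWalks l)))

module Submission where

-- A walk is standard from 0 to 0 iff, started at height 0, it never goes below 0 and ends at 0.
-- Let Ret d sum the weights of walks from height d that never go below 0 and end at 0, and
-- FirstRet d those from height d + 1 that reach 0 only at their end. Splitting off the first step
-- gives recurrences for both families, and from these, by induction on the length,
--   Ret (d + 1) = FirstRet d · Ret 0   (cut at the first visit to 0),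
--   FirstRet d  = z · Ret d · A        (split off the last step).
-- A primitive walk is a single stay step, or an up step followed by a first return from height 1,
-- so H = Bz + C · FirstRet 0 · z = Bz + C G A z². The first identity gives G = 1 + H G, which
-- unrolls to G = 1 + H + H² + ⋯ because H has no constant term.

open import Level using (Level)
open import Algebra.Bundles using (Ring)
open import Data.Bool using (Bool; true; false; T; if_then_else_)
open import Data.Empty using (⊥-elim)
open import Data.Fin as Fin using (toℕ)
open import Data.Integer as ℤ using (ℤ; +_; +≤+)
import Data.Integer.Properties as ℤP
open import Data.List using (List; []; _∷_; map; filter; concatMap; _++_)
open import Data.List.Properties using (map-∘; map-++)
open import Data.Nat using (ℕ; zero; suc; _∸_; _≤_; _<_; s≤s; z≤n)
import Data.Nat.Properties as ℕP
open import Data.Product using (_×_; _,_; proj₂)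
open import Data.Unit using (tt)
open import Data.Vec using (Vec; []; _∷_)
open import Function using (_∘_)
open import Relation.Binary.PropositionalEquality as ≡ using (_≡_; _≢_)
open import Relation.Nullary using (Dec; does)
open import Relation.Nullary.Decidable using (dec-true; dec-false)
open import Relation.Unary using (Decidable)
open import Defs

does-≡ : ∀ {p} {P : Set p} (P? : Dec P) {b : Bool} → (P → T b) → (T b → P) → does P? ≡ b
does-≡ P? {true}  _  from = dec-true P? (from tt)
does-≡ P? {false} to _    = dec-false P? to

Returns : ∀ {l} → ℤ → Vec Step l → Set
Returns o ss = (o ℤ.+ final ss ≡ + 0) × (∀ i → + 0 ℤ.≤ o ℤ.+ pos ss i)

FirstReturn : ∀ {l} → ℤ → Vec Step l → Set
FirstReturn {l} o ss = Returns o ss × (∀ j → toℕ j < l → o ℤ.+ pos ss j ≢ + 0)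

returnsᵇ : ∀ {l} → ℕ → Vec Step l → Bool
returnsᵇ h       (stay ∷ ss) = returnsᵇ h ss
returnsᵇ h       (up ∷ ss)   = returnsᵇ (suc h) ss
returnsᵇ zero    []          = true
returnsᵇ (suc h) []          = false
returnsᵇ zero    (down ∷ ss) = false
returnsᵇ (suc h) (down ∷ ss) = returnsᵇ h ss

-- Decides FirstReturn (+ suc h).
firstReturnᵇ : ∀ {l} → ℕ → Vec Step l → Bool
firstReturnᵇ h       []             = false
firstReturnᵇ h       (stay ∷ ss)    = firstReturnᵇ h ss
firstReturnᵇ h       (up ∷ ss)      = firstReturnᵇ (suc h) ss
firstReturnᵇ zero    (down ∷ [])    = true
firstReturnᵇ zero    (down ∷ _ ∷ _) = false
firstReturnᵇ (suc h) (down ∷ ss)    = firstReturnᵇ h ss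

primitiveᵇ : ∀ {l} → Vec Step l → Bool
primitiveᵇ []             = false
primitiveᵇ (down ∷ _)     = false
primitiveᵇ (stay ∷ [])    = true
primitiveᵇ (stay ∷ _ ∷ _) = false
primitiveᵇ (up ∷ ss)      = firstReturnᵇ zero ss

+-step-pos : ∀ o s {l} (ss : Vec Step l) i → o ℤ.+ pos (s ∷ ss) (Fin.suc i) ≡ (o ℤ.+ stepℤ s) ℤ.+ pos ss i
+-step-pos o s ss i = ≡.sym (ℤP.+-assoc o (stepℤ s) (pos ss i))

+-step-final : ∀ o s {l} (ss : Vec Step l) → o ℤ.+ final (s ∷ ss) ≡ (o ℤ.+ stepℤ s) ℤ.+ final ss
+-step-final o s ss = ≡.sym (ℤP.+-assoc o (stepℤ s) (final ss))

Returns-∷⁻ : ∀ {l} o s (ss : Vec Step l) → Returns o (s ∷ ss) → (+ 0 ℤ.≤ o) × Returns (o ℤ.+ stepℤ s) ss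
Returns-∷⁻ o s ss (ends , above) =
  ≡.subst (+ 0 ℤ.≤_) (ℤP.+-identityʳ o) (above Fin.zero) ,
  ≡.trans (≡.sym (+-step-final o s ss)) ends ,
  λ i → ≡.subst (+ 0 ℤ.≤_) (+-step-pos o s ss i) (above (Fin.suc i))

Returns-∷⁺ : ∀ {l} o s (ss : Vec Step l) → + 0 ℤ.≤ o → Returns (o ℤ.+ stepℤ s) ss → Returns o (s ∷ ss)
Returns-∷⁺ o s ss 0≤o (ends , above) = ≡.trans (+-step-final o s ss) ends , above′
  where
  above′ : ∀ i → + 0 ℤ.≤ o ℤ.+ pos (s ∷ ss) i
  above′ Fin.zero    = ≡.subst (+ 0 ℤ.≤_) (≡.sym (ℤP.+-identityʳ o)) 0≤o
  above′ (Fin.suc i) = ≡.subst (+ 0 ℤ.≤_) (≡.sym (+-step-pos o s ss i)) (above i)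

FirstReturn-∷⁻ : ∀ {l} o s (ss : Vec Step l) → FirstReturn o (s ∷ ss) → FirstReturn (o ℤ.+ stepℤ s) ss
FirstReturn-∷⁻ o s ss (returns , positive) =
  proj₂ (Returns-∷⁻ o s ss returns) ,
  λ j j<l eq → positive (Fin.suc j) (s≤s j<l) (≡.trans (+-step-pos o s ss j) eq)

FirstReturn-∷⁺ : ∀ {l} h s (ss : Vec Step l) → FirstReturn (+ suc h ℤ.+ stepℤ s) ss → FirstReturn (+ suc h) (s ∷ ss)
FirstReturn-∷⁺ h s ss (returns , positive) = Returns-∷⁺ (+ suc h) s ss (+≤+ z≤n) returns , positive′
  where
  positive′ : ∀ j → toℕ j < suc _ → + suc h ℤ.+ pos (s ∷ ss) j ≢ + 0
  positive′ Fin.zero    _         ()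
  positive′ (Fin.suc j) (s≤s j<l) eq = positive j j<l (≡.trans (≡.sym (+-step-pos (+ suc h) s ss j)) eq)

+-stay : ∀ h → + h ℤ.+ stepℤ stay ≡ + h
+-stay h = ≡.cong +_ (ℕP.+-identityʳ h)

+-up : ∀ h → + h ℤ.+ stepℤ up ≡ + suc h
+-up h = ≡.cong +_ (ℕP.+-comm h 1)

returnsᵇ-complete : ∀ {l} h (ss : Vec Step l) → Returns (+ h) ss → T (returnsᵇ h ss)
returnsᵇ-complete zero    []          _ = tt
returnsᵇ-complete (suc h) []          (() , _)
returnsᵇ-complete zero    (down ∷ ss) r with proj₂ (proj₂ (Returns-∷⁻ (+ 0) down ss r)) Fin.zero
... | ()
returnsᵇ-complete (suc h) (down ∷ ss) r = returnsᵇ-complete h ss (proj₂ (Returns-∷⁻ (+ suc h) down ss r))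
returnsᵇ-complete h (stay ∷ ss) r =
  returnsᵇ-complete h ss (≡.subst (λ o → Returns o ss) (+-stay h) (proj₂ (Returns-∷⁻ (+ h) stay ss r)))
returnsᵇ-complete h (up ∷ ss) r =
  returnsᵇ-complete (suc h) ss (≡.subst (λ o → Returns o ss) (+-up h) (proj₂ (Returns-∷⁻ (+ h) up ss r)))

returnsᵇ-sound : ∀ {l} h (ss : Vec Step l) → T (returnsᵇ h ss) → Returns (+ h) ss
returnsᵇ-sound zero    []          _ = ≡.refl , λ { Fin.zero → +≤+ z≤n }
returnsᵇ-sound (suc h) (down ∷ ss) r = Returns-∷⁺ (+ suc h) down ss (+≤+ z≤n) (returnsᵇ-sound h ss r)
returnsᵇ-sound h (stay ∷ ss) r =
  Returns-∷⁺ (+ h) stay ss (+≤+ z≤n) (≡.subst (λ o → Returns o ss) (≡.sym (+-stay h)) (returnsᵇ-sound h ss r))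
returnsᵇ-sound h (up ∷ ss) r =
  Returns-∷⁺ (+ h) up ss (+≤+ z≤n) (≡.subst (λ o → Returns o ss) (≡.sym (+-up h)) (returnsᵇ-sound (suc h) ss r))

FirstReturn-from-0-empty : ∀ {l} (ss : Vec Step l) → FirstReturn (+ 0) ss → l ≡ 0
FirstReturn-from-0-empty []      _              = ≡.refl
FirstReturn-from-0-empty (_ ∷ _) (_ , positive) = ⊥-elim (positive Fin.zero (s≤s z≤n) ≡.refl)

firstReturnᵇ-complete : ∀ {l} h (ss : Vec Step l) → FirstReturn (+ suc h) ss → T (firstReturnᵇ h ss)
firstReturnᵇ-complete h       []                 ((() , _) , _)
firstReturnᵇ-complete zero    (down ∷ [])        _ = tt
firstReturnᵇ-complete zero    (down ∷ s ∷ ss)    r with FirstReturn-from-0-empty (s ∷ ss) (FirstReturn-∷⁻ (+ 1) down (s ∷ ss) r)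
... | ()
firstReturnᵇ-complete (suc h) (down ∷ ss) r = firstReturnᵇ-complete h ss (FirstReturn-∷⁻ (+ suc (suc h)) down ss r)
firstReturnᵇ-complete h (stay ∷ ss) r =
  firstReturnᵇ-complete h ss (≡.subst (λ o → FirstReturn o ss) (+-stay (suc h)) (FirstReturn-∷⁻ (+ suc h) stay ss r))
firstReturnᵇ-complete h (up ∷ ss) r =
  firstReturnᵇ-complete (suc h) ss (≡.subst (λ o → FirstReturn o ss) (+-up (suc h)) (FirstReturn-∷⁻ (+ suc h) up ss r))

firstReturnᵇ-sound : ∀ {l} h (ss : Vec Step l) → T (firstReturnᵇ h ss) → FirstReturn (+ suc h) ss
firstReturnᵇ-sound zero    (down ∷ [])  _ =
  FirstReturn-∷⁺ zero down [] ((≡.refl , λ { Fin.zero → +≤+ z≤n }) , λ { _ () })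
firstReturnᵇ-sound (suc h) (down ∷ ss) r = FirstReturn-∷⁺ (suc h) down ss (firstReturnᵇ-sound h ss r)
firstReturnᵇ-sound h (stay ∷ ss) r =
  FirstReturn-∷⁺ h stay ss (≡.subst (λ o → FirstReturn o ss) (≡.sym (+-stay (suc h))) (firstReturnᵇ-sound h ss r))
firstReturnᵇ-sound h (up ∷ ss) r =
  FirstReturn-∷⁺ h up ss (≡.subst (λ o → FirstReturn o ss) (≡.sym (+-up (suc h))) (firstReturnᵇ-sound (suc h) ss r))

IsStandard00⇒Returns : ∀ {l} (ss : Vec Step l) → IsStandard00 ss → Returns (+ 0) ss
IsStandard00⇒Returns ss (ends , above) = ≡.trans (ℤP.+-identityˡ _) ends ,
  λ i → ≡.subst (+ 0 ℤ.≤_) (≡.sym (ℤP.+-identityˡ _)) (≡.subst (ℤ._≤ pos ss i) ends (above i))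

Returns⇒IsStandard00 : ∀ {l} (ss : Vec Step l) → Returns (+ 0) ss → IsStandard00 ss
Returns⇒IsStandard00 ss (ends , above) = ends′ ,
  λ i → ≡.subst (ℤ._≤ pos ss i) (≡.sym ends′) (≡.subst (+ 0 ℤ.≤_) (ℤP.+-identityˡ _) (above i))
  where ends′ = ≡.trans (≡.sym (ℤP.+-identityˡ _)) ends

does-isStandard00? : ∀ {l} (ss : Vec Step l) → does (isStandard00? ss) ≡ returnsᵇ 0 ss
does-isStandard00? ss = does-≡ (isStandard00? ss)
  (returnsᵇ-complete 0 ss ∘ IsStandard00⇒Returns ss)
  (Returns⇒IsStandard00 ss ∘ returnsᵇ-sound 0 ss)

primitiveᵇ-complete : ∀ {l} (ss : Vec Step l) → IsPrimStandard00 ss → T (primitiveᵇ ss)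
primitiveᵇ-complete []             (_ , () , _)
primitiveᵇ-complete (down ∷ ss)    (standard , _) = returnsᵇ-complete 0 (down ∷ ss) (IsStandard00⇒Returns _ standard)
primitiveᵇ-complete (stay ∷ [])    _ = tt
primitiveᵇ-complete (stay ∷ _ ∷ _) (_ , _ , avoids) = avoids (Fin.suc Fin.zero) (s≤s z≤n) (s≤s (s≤s z≤n)) ≡.refl
primitiveᵇ-complete (up ∷ ss)      (standard , _ , avoids) = firstReturnᵇ-complete 0 ss
  (proj₂ (Returns-∷⁻ (+ 0) up ss (IsStandard00⇒Returns _ standard)) ,
   λ j j<l → avoids (Fin.suc j) (s≤s z≤n) (s≤s j<l))

primitiveᵇ-sound : ∀ {l} (ss : Vec Step l) → T (primitiveᵇ ss) → IsPrimStandard00 ss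
primitiveᵇ-sound (stay ∷ []) _ =
  Returns⇒IsStandard00 _ (returnsᵇ-sound 0 (stay ∷ []) tt) , s≤s z≤n ,
  λ { Fin.zero () _ ; (Fin.suc _) _ (s≤s ()) }
primitiveᵇ-sound (up ∷ ss) r with firstReturnᵇ-sound 0 ss r
... | returns , positive =
  Returns⇒IsStandard00 _ (Returns-∷⁺ (+ 0) up ss (+≤+ z≤n) returns) , s≤s z≤n , avoids
  where
  avoids : ∀ i → 0 < toℕ i → toℕ i < suc _ → pos (up ∷ ss) i ≢ + 0
  avoids (Fin.suc j) _ (s≤s j<l) = positive j j<l

does-isPrimStandard00? : ∀ {l} (ss : Vec Step l) → does (isPrimStandard00? ss) ≡ primitiveᵇ ss
does-isPrimStandard00? ss = does-≡ (isPrimStandard00? ss) (primitiveᵇ-complete ss) (primitiveᵇ-sound ss)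

module SeriesProperties {c ℓ : Level} (R : Ring c ℓ) where
  open Ring R hiding (zero)
  open Series R
  open import Relation.Binary.Reasoning.Setoid setoid
  open import Algebra.Properties.CommutativeSemigroup +-commutativeSemigroup using (interchange)

  Σ≤-cong : ∀ n {f g : ℕ → Carrier} → (∀ i → f i ≈ g i) → Σ≤ n f ≈ Σ≤ n g
  Σ≤-cong zero    f≈g = f≈g 0
  Σ≤-cong (suc n) f≈g = +-cong (Σ≤-cong n f≈g) (f≈g (suc n))

  Σ≤-cong-≤ : ∀ n {f g : ℕ → Carrier} → (∀ {i} → i ≤ n → f i ≈ g i) → Σ≤ n f ≈ Σ≤ n g
  Σ≤-cong-≤ zero    f≈g = f≈g z≤n
  Σ≤-cong-≤ (suc n) f≈g = +-cong (Σ≤-cong-≤ n (f≈g ∘ ℕP.m≤n⇒m≤1+n)) (f≈g ℕP.≤-refl)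

  Σ≤-suc : ∀ n (f : ℕ → Carrier) → Σ≤ (suc n) f ≈ f 0 + Σ≤ n (f ∘ suc)
  Σ≤-suc zero    f = refl
  Σ≤-suc (suc n) f = trans (+-cong (Σ≤-suc n f) refl) (+-assoc _ _ _)

  Σ≤-zero : ∀ n {f : ℕ → Carrier} → (∀ i → f i ≈ 0#) → Σ≤ n f ≈ 0#
  Σ≤-zero zero    f≈0 = f≈0 0
  Σ≤-zero (suc n) f≈0 = trans (+-cong (Σ≤-zero n f≈0) (f≈0 (suc n))) (+-identityˡ _)

  Σ≤-+ : ∀ n (f g : ℕ → Carrier) → Σ≤ n (λ i → f i + g i) ≈ Σ≤ n f + Σ≤ n g
  Σ≤-+ zero    f g = refl
  Σ≤-+ (suc n) f g = trans (+-cong (Σ≤-+ n f g) refl) (interchange _ _ _ _)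

  Σ≤-*ˡ : ∀ n a (f : ℕ → Carrier) → Σ≤ n (λ i → a * f i) ≈ a * Σ≤ n f
  Σ≤-*ˡ zero    a f = refl
  Σ≤-*ˡ (suc n) a f = trans (+-cong (Σ≤-*ˡ n a f) refl) (sym (distribˡ a _ _))

  Σ≤-comm : ∀ m n (f : ℕ → ℕ → Carrier) → Σ≤ m (λ k → Σ≤ n (f k)) ≈ Σ≤ n (λ i → Σ≤ m (λ k → f k i))
  Σ≤-comm zero    n f = refl
  Σ≤-comm (suc m) n f = trans (+-cong (Σ≤-comm m n f) refl) (sym (Σ≤-+ n _ _))

  ⊛-congˡ : ∀ n {f g : PowerSeries} (h : PowerSeries) → f ≋ g → (f ⊛ h) n ≈ (g ⊛ h) n
  ⊛-congˡ n h f≈g = Σ≤-cong n (λ i → *-cong (f≈g i) refl)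

  ⊛-congʳ : ∀ n (f : PowerSeries) {g h : PowerSeries} → g ≋ h → (f ⊛ g) n ≈ (f ⊛ h) n
  ⊛-congʳ n f g≈h = Σ≤-cong n (λ i → *-cong refl (g≈h (n ∸ i)))

  ⊛-zeroˡ : ∀ n (f : PowerSeries) → ((λ _ → 0#) ⊛ f) n ≈ 0#
  ⊛-zeroˡ n f = Σ≤-zero n (λ i → zeroˡ (f (n ∸ i)))

  ⊛-zeroʳ : ∀ n (f : PowerSeries) → (f ⊛ (λ _ → 0#)) n ≈ 0#
  ⊛-zeroʳ n f = Σ≤-zero n (λ i → zeroʳ (f i))

  ⊛-zero-at-0 : ∀ (f g : PowerSeries) → f 0 ≈ 0# → (f ⊛ g) 0 ≈ 0#
  ⊛-zero-at-0 f g f0≈0 = trans (*-cong f0≈0 refl) (zeroˡ (g 0))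

  ⊛-sucˡ : ∀ n (f g : PowerSeries) → f 0 ≈ 0# → (f ⊛ g) (suc n) ≈ ((f ∘ suc) ⊛ g) n
  ⊛-sucˡ n f g f0≈0 = begin
    (f ⊛ g) (suc n)                      ≈⟨ Σ≤-suc n _ ⟩
    f 0 * g (suc n) + ((f ∘ suc) ⊛ g) n  ≈⟨ +-cong (trans (*-cong f0≈0 refl) (zeroˡ _)) refl ⟩
    0# + ((f ∘ suc) ⊛ g) n               ≈⟨ +-identityˡ _ ⟩
    ((f ∘ suc) ⊛ g) n                    ∎

  -- suc n ∸ i is suc (n ∸ i) only for i ≤ n, so the last term is split off first.
  ⊛-sucʳ : ∀ n (f g : PowerSeries) → (f ⊛ g) (suc n) ≈ (f ⊛ (g ∘ suc)) n + f (suc n) * g 0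
  ⊛-sucʳ n f g = +-cong (Σ≤-cong-≤ n below) (*-cong refl (reflexive (≡.cong g (ℕP.n∸n≡0 n))))
    where
    below : ∀ {i} → i ≤ n → f i * g (suc n ∸ i) ≈ f i * g (suc (n ∸ i))
    below i≤n = *-cong refl (reflexive (≡.cong g (ℕP.+-∸-assoc 1 i≤n)))

  const-⊛ : ∀ n a (f : PowerSeries) → (const a ⊛ f) n ≈ a * f n
  const-⊛ zero    a f = refl
  const-⊛ (suc n) a f = begin
    (const a ⊛ f) (suc n)                        ≈⟨ Σ≤-suc n _ ⟩
    a * f (suc n) + Σ≤ n (λ i → 0# * f (n ∸ i))  ≈⟨ +-cong refl (Σ≤-zero n (λ i → zeroˡ _)) ⟩
    a * f (suc n) + 0#                            ≈⟨ +-identityʳ _ ⟩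
    a * f (suc n)                                 ∎

  ⊛-const : ∀ n (f : PowerSeries) a → (f ⊛ const a) n ≈ f n * a
  ⊛-const zero    f a = refl
  ⊛-const (suc n) f a = begin
    (f ⊛ const a) (suc n)                      ≈⟨ ⊛-sucʳ n f (const a) ⟩
    (f ⊛ (λ _ → 0#)) n + f (suc n) * a         ≈⟨ +-cong (⊛-zeroʳ n f) refl ⟩
    0# + f (suc n) * a                         ≈⟨ +-identityˡ _ ⟩
    f (suc n) * a                              ∎

  one-⊛ : ∀ n (f : PowerSeries) → (one ⊛ f) n ≈ f n
  one-⊛ n f = trans (const-⊛ n 1# f) (*-identityˡ (f n))

  ⊛-one : ∀ n (f : PowerSeries) → (f ⊛ one) n ≈ f n
  ⊛-one n f = trans (⊛-const n f 1#) (*-identityʳ (f n))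

  Z∘suc≋one : (Z ∘ suc) ≋ one
  Z∘suc≋one zero    = refl
  Z∘suc≋one (suc n) = refl

  ⊛-Z-zero : ∀ (f : PowerSeries) → (f ⊛ Z) 0 ≈ 0#
  ⊛-Z-zero f = zeroʳ (f 0)

  ⊛-Z-suc : ∀ n (f : PowerSeries) → (f ⊛ Z) (suc n) ≈ f n
  ⊛-Z-suc n f = begin
    (f ⊛ Z) (suc n)                     ≈⟨ ⊛-sucʳ n f Z ⟩
    (f ⊛ (Z ∘ suc)) n + f (suc n) * 0#  ≈⟨ +-cong (⊛-congʳ n f Z∘suc≋one) (zeroʳ _) ⟩
    (f ⊛ one) n + 0#                    ≈⟨ +-identityʳ _ ⟩
    (f ⊛ one) n                         ≈⟨ ⊛-one n f ⟩
    f n                                 ∎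

  ⊛-Z²-zero : ∀ (f : PowerSeries) → (f ⊛ (Z ⊛ Z)) 0 ≈ 0#
  ⊛-Z²-zero f = trans (*-cong refl (⊛-Z-zero Z)) (zeroʳ (f 0))

  ⊛-Z²-suc : ∀ n (f : PowerSeries) → (f ⊛ (Z ⊛ Z)) (suc n) ≈ (f ⊛ Z) n
  ⊛-Z²-suc n f = begin
    (f ⊛ (Z ⊛ Z)) (suc n)                                  ≈⟨ ⊛-sucʳ n f (Z ⊛ Z) ⟩
    (f ⊛ ((Z ⊛ Z) ∘ suc)) n + f (suc n) * (Z ⊛ Z) 0        ≈⟨ +-cong (⊛-congʳ n f (λ i → ⊛-Z-suc i Z)) (trans (*-cong refl (⊛-Z-zero Z)) (zeroʳ _)) ⟩
    (f ⊛ Z) n + 0#                                          ≈⟨ +-identityʳ _ ⟩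
    (f ⊛ Z) n                                               ∎

  ⊛-congʳ-< : ∀ n (f : PowerSeries) {g h : PowerSeries} → f 0 ≈ 0# →
              (∀ {m} → m < n → g m ≈ h m) → (f ⊛ g) n ≈ (f ⊛ h) n
  ⊛-congʳ-< zero    f {g} {h} f0≈0 _   = trans (⊛-zero-at-0 f g f0≈0) (sym (⊛-zero-at-0 f h f0≈0))
  ⊛-congʳ-< (suc n) f {g} {h} f0≈0 g≈h = begin
    (f ⊛ g) (suc n)    ≈⟨ ⊛-sucˡ n f g f0≈0 ⟩
    ((f ∘ suc) ⊛ g) n  ≈⟨ Σ≤-cong n (λ i → *-cong refl (g≈h (s≤s (ℕP.m∸n≤m n i)))) ⟩
    ((f ∘ suc) ⊛ h) n  ≈⟨ sym (⊛-sucˡ n f h f0≈0) ⟩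
    (f ⊛ h) (suc n)    ∎

  geomPartial-suc : ∀ N n (f : PowerSeries) → geomPartial f (suc N) n ≈ one n + (f ⊛ geomPartial f N) n
  geomPartial-suc N n f = begin
    geomPartial f (suc N) n                                    ≈⟨ Σ≤-suc N _ ⟩
    one n + Σ≤ N (λ k → (f ⊛ (f ^ˢ k)) n)                      ≈⟨ +-cong refl (Σ≤-comm N n _) ⟩
    one n + Σ≤ n (λ i → Σ≤ N (λ k → f i * (f ^ˢ k) (n ∸ i)))  ≈⟨ +-cong refl (Σ≤-cong n (λ i → Σ≤-*ˡ N (f i) _)) ⟩
    one n + (f ⊛ geomPartial f N) n                            ∎

  -- Inside the range n ≤ N the truncation of 1 + f + f² + ⋯ at f^N is invisible, because f 0 ≈ 0.
  fixedPoint≈geomPartial : ∀ (f x : PowerSeries) → f 0 ≈ 0# → (∀ n → x n ≈ one n + (f ⊛ x) n) →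
                           ∀ N n → n ≤ N → x n ≈ geomPartial f N n
  fixedPoint≈geomPartial f x f0≈0 x≈1+fx zero .zero z≤n = begin
    x 0                ≈⟨ x≈1+fx 0 ⟩
    1# + (f ⊛ x) 0     ≈⟨ +-cong refl (⊛-zero-at-0 f x f0≈0) ⟩
    1# + 0#            ≈⟨ +-identityʳ 1# ⟩
    1#                 ∎
  fixedPoint≈geomPartial f x f0≈0 x≈1+fx (suc N) n n≤1+N = begin
    x n                              ≈⟨ x≈1+fx n ⟩
    one n + (f ⊛ x) n                ≈⟨ +-cong refl (⊛-congʳ-< n f f0≈0 x≈partial) ⟩
    one n + (f ⊛ geomPartial f N) n  ≈⟨ sym (geomPartial-suc N n f) ⟩
    geomPartial f (suc N) n          ∎
    where
    x≈partial : ∀ {m} → m < n → x m ≈ geomPartial f N m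
    x≈partial m<n = fixedPoint≈geomPartial f x f0≈0 x≈1+fx N _ (ℕP.≤-pred (ℕP.≤-trans m<n n≤1+N))

module WalkSeries {c ℓ : Level} (R : Ring c ℓ) (A B C : Ring.Carrier R) where
  open Ring R hiding (zero)
  open Series R
  open Walks A B C
  open SeriesProperties R
  open import Relation.Binary.Reasoning.Setoid setoid

  sumL-++ : ∀ xs ys → sumL (xs ++ ys) ≈ sumL xs + sumL ys
  sumL-++ []       ys = sym (+-identityˡ _)
  sumL-++ (x ∷ xs) ys = trans (+-cong refl (sumL-++ xs ys)) (sym (+-assoc _ _ _))

  sumL-concatMap : ∀ {X Y : Set} (f : Y → Carrier) (g : X → List Y) xs →
                   sumL (map f (concatMap g xs)) ≈ sumL (map (λ x → sumL (map f (g x))) xs)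
  sumL-concatMap f g []       = refl
  sumL-concatMap f g (x ∷ xs) = begin
    sumL (map f (g x ++ concatMap g xs))                   ≡⟨ ≡.cong sumL (map-++ f (g x) _) ⟩
    sumL (map f (g x) ++ map f (concatMap g xs))           ≈⟨ sumL-++ (map f (g x)) _ ⟩
    sumL (map f (g x)) + sumL (map f (concatMap g xs))     ≈⟨ +-cong refl (sumL-concatMap f g xs) ⟩
    sumL (map (λ x → sumL (map f (g x))) (x ∷ xs))         ∎

  sumL-filter : ∀ {X : Set} (f : X → Carrier) {P : X → Set} (P? : Decidable P) xs →
                sumL (map f (filter P? xs)) ≈ sumL (map (λ x → if does (P? x) then f x else 0#) xs)
  sumL-filter f P? []       = refl
  sumL-filter f P? (x ∷ xs) with does (P? x)
  ... | true  = +-cong refl (sumL-filter f P? xs)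
  ... | false = trans (sumL-filter f P? xs) (sym (+-identityˡ _))

  sumL-cong : ∀ {X : Set} {f g : X → Carrier} xs → (∀ x → f x ≈ g x) → sumL (map f xs) ≈ sumL (map g xs)
  sumL-cong []       f≈g = refl
  sumL-cong (x ∷ xs) f≈g = +-cong (f≈g x) (sumL-cong xs f≈g)

  ΣWalks : (l : ℕ) → (Vec Step l → Carrier) → Carrier
  ΣWalks zero    f = f []
  ΣWalks (suc l) f = ΣWalks l (f ∘ (down ∷_)) + (ΣWalks l (f ∘ (stay ∷_)) + ΣWalks l (f ∘ (up ∷_)))

  sumL-allWalks : ∀ l (f : Vec Step l → Carrier) → sumL (map f (allWalks l)) ≈ ΣWalks l f
  sumL-allWalks zero    f = +-identityʳ (f [])
  sumL-allWalks (suc l) f = begin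
    sumL (map f (allWalks (suc l)))
      ≈⟨ sumL-concatMap f (λ s → map (s ∷_) (allWalks l)) (down ∷ stay ∷ up ∷ []) ⟩
    branch down + (branch stay + (branch up + 0#))
      ≈⟨ +-cong (by-branch down) (+-cong (by-branch stay) (trans (+-identityʳ _) (by-branch up))) ⟩
    ΣWalks (suc l) f
      ∎
    where
    branch : Step → Carrier
    branch s = sumL (map f (map (s ∷_) (allWalks l)))
    by-branch : ∀ s → branch s ≈ ΣWalks l (f ∘ (s ∷_))
    by-branch s = trans (reflexive (≡.cong sumL (≡.sym (map-∘ (allWalks l))))) (sumL-allWalks l (f ∘ (s ∷_)))

  ΣWalks-cong : ∀ l {f g : Vec Step l → Carrier} → (∀ ss → f ss ≈ g ss) → ΣWalks l f ≈ ΣWalks l g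
  ΣWalks-cong zero    f≈g = f≈g []
  ΣWalks-cong (suc l) f≈g =
    +-cong (ΣWalks-cong l (f≈g ∘ _)) (+-cong (ΣWalks-cong l (f≈g ∘ _)) (ΣWalks-cong l (f≈g ∘ _)))

  ΣWalks-zero : ∀ l → ΣWalks l (λ _ → 0#) ≈ 0#
  ΣWalks-zero zero    = refl
  ΣWalks-zero (suc l) = trans (+-cong (ΣWalks-zero l) (+-cong (ΣWalks-zero l) (ΣWalks-zero l)))
                              (trans (+-identityˡ _) (+-identityˡ _))

  ΣWalks-*ˡ : ∀ l a (f : Vec Step l → Carrier) → ΣWalks l (λ ss → a * f ss) ≈ a * ΣWalks l f
  ΣWalks-*ˡ zero    a f = refl
  ΣWalks-*ˡ (suc l) a f = begin
    ΣWalks (suc l) (λ ss → a * f ss)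
      ≈⟨ +-cong (ΣWalks-*ˡ l a _) (+-cong (ΣWalks-*ˡ l a _) (ΣWalks-*ˡ l a _)) ⟩
    a * ΣWalks l (f ∘ (down ∷_)) + (a * ΣWalks l (f ∘ (stay ∷_)) + a * ΣWalks l (f ∘ (up ∷_)))
      ≈⟨ +-cong refl (sym (distribˡ a _ _)) ⟩
    a * ΣWalks l (f ∘ (down ∷_)) + a * (ΣWalks l (f ∘ (stay ∷_)) + ΣWalks l (f ∘ (up ∷_)))
      ≈⟨ sym (distribˡ a _ _) ⟩
    a * ΣWalks (suc l) f
      ∎

  weightIf : ∀ {l} → Bool → Vec Step l → Carrier
  weightIf b ss = if b then weight ss else 0#

  weightIf-∷ : ∀ {l} b s (ss : Vec Step l) → weightIf b (s ∷ ss) ≈ U s * weightIf b ss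
  weightIf-∷ true  s []      = sym (*-identityʳ (U s))
  weightIf-∷ true  s (_ ∷ _) = refl
  weightIf-∷ false s ss      = sym (zeroʳ (U s))

  ΣWalks-∷ : ∀ l s (p : Vec Step l → Bool) →
             ΣWalks l (λ ss → weightIf (p ss) (s ∷ ss)) ≈ U s * ΣWalks l (λ ss → weightIf (p ss) ss)
  ΣWalks-∷ l s p = trans (ΣWalks-cong l (λ ss → weightIf-∷ (p ss) s ss)) (ΣWalks-*ˡ l (U s) _)

  sumL-filter≈ΣWalks : ∀ l {P : Vec Step l → Set} (P? : Decidable P) (p : Vec Step l → Bool) →
                       (∀ ss → does (P? ss) ≡ p ss) →
                       sumL (map weight (filter P? (allWalks l))) ≈ ΣWalks l (λ ss → weightIf (p ss) ss)
  sumL-filter≈ΣWalks l P? p does≡p = begin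
    sumL (map weight (filter P? (allWalks l)))                   ≈⟨ sumL-filter weight P? (allWalks l) ⟩
    sumL (map (λ ss → weightIf (does (P? ss)) ss) (allWalks l))  ≈⟨ sumL-cong (allWalks l) (λ ss → reflexive (≡.cong (λ b → weightIf b ss) (does≡p ss))) ⟩
    sumL (map (λ ss → weightIf (p ss) ss) (allWalks l))          ≈⟨ sumL-allWalks l _ ⟩
    ΣWalks l (λ ss → weightIf (p ss) ss)                         ∎

  walkSeries : (∀ {l} → Vec Step l → Bool) → PowerSeries
  walkSeries p l = ΣWalks l (λ ss → weightIf (p ss) ss)

  Ret FirstRet : ℕ → PowerSeries
  Ret d      = walkSeries (returnsᵇ d)
  FirstRet d = walkSeries (firstReturnᵇ d)

  Prim : PowerSeries
  Prim = walkSeries primitiveᵇ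

  G≋Ret0 : G ≋ Ret 0
  G≋Ret0 l = sumL-filter≈ΣWalks l isStandard00? (returnsᵇ 0) does-isStandard00?

  H≋Prim : H ≋ Prim
  H≋Prim l = sumL-filter≈ΣWalks l isPrimStandard00? primitiveᵇ does-isPrimStandard00?

  -- Splits a walk sum by the first step: x, y, z are the sums after a down, stay, up step.
  step : Carrier → Carrier → Carrier → Carrier
  step x y z = A * x + (B * y + C * z)

  step-cong : ∀ {x x′ y y′ z z′} → x ≈ x′ → y ≈ y′ → z ≈ z′ → step x y z ≈ step x′ y′ z′
  step-cong x≈x′ y≈y′ z≈z′ = +-cong (*-cong refl x≈x′) (+-cong (*-cong refl y≈y′) (*-cong refl z≈z′))

  step-*ʳ : ∀ x y z e → step x y z * e ≈ step (x * e) (y * e) (z * e)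
  step-*ʳ x y z e = begin
    (A * x + (B * y + C * z)) * e              ≈⟨ distribʳ e _ _ ⟩
    (A * x) * e + (B * y + C * z) * e          ≈⟨ +-cong refl (distribʳ e _ _) ⟩
    (A * x) * e + ((B * y) * e + (C * z) * e)  ≈⟨ +-cong (*-assoc A x e) (+-cong (*-assoc B y e) (*-assoc C z e)) ⟩
    step (x * e) (y * e) (z * e)               ∎

  step-⊛ : ∀ n (f g h k : PowerSeries) →
           ((λ j → step (f j) (g j) (h j)) ⊛ k) n ≈ step ((f ⊛ k) n) ((g ⊛ k) n) ((h ⊛ k) n)
  step-⊛ n f g h k = begin
    ((λ j → step (f j) (g j) (h j)) ⊛ k) n
      ≈⟨ Σ≤-cong n (λ i → step-*ʳ (f i) (g i) (h i) (k (n ∸ i))) ⟩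
    Σ≤ n (λ i → step (f i * k (n ∸ i)) (g i * k (n ∸ i)) (h i * k (n ∸ i)))
      ≈⟨ Σ≤-+ n _ _ ⟩
    Σ≤ n (λ i → A * (f i * k (n ∸ i))) + Σ≤ n (λ i → B * (g i * k (n ∸ i)) + C * (h i * k (n ∸ i)))
      ≈⟨ +-cong (Σ≤-*ˡ n A _) (trans (Σ≤-+ n _ _) (+-cong (Σ≤-*ˡ n B _) (Σ≤-*ˡ n C _))) ⟩
    step ((f ⊛ k) n) ((g ⊛ k) n) ((h ⊛ k) n)
      ∎

  -- Ret↓ d and FirstRet↓ d play the role of Ret (d - 1) and FirstRet (d - 1); a down step from
  -- height 0 is impossible for a return, and ends a first return from height 1.
  Ret↓ FirstRet↓ : ℕ → PowerSeries
  Ret↓ zero    = λ _ → 0#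
  Ret↓ (suc d) = Ret d
  FirstRet↓ zero    = one
  FirstRet↓ (suc d) = FirstRet d

  Ret-suc : ∀ d l → Ret d (suc l) ≈ step (Ret↓ d l) (Ret d l) (Ret (suc d) l)
  Ret-suc zero    l = +-cong (trans (ΣWalks-zero l) (sym (zeroʳ A)))
                             (+-cong (ΣWalks-∷ l stay (returnsᵇ 0)) (ΣWalks-∷ l up (returnsᵇ 1)))
  Ret-suc (suc d) l = +-cong (ΣWalks-∷ l down (returnsᵇ d))
                             (+-cong (ΣWalks-∷ l stay (returnsᵇ (suc d))) (ΣWalks-∷ l up (returnsᵇ (suc (suc d)))))

  FirstRet-suc : ∀ d l → FirstRet d (suc l) ≈ step (FirstRet↓ d l) (FirstRet d l) (FirstRet (suc d) l)
  FirstRet-suc zero    l = +-cong (down-last l)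
                                  (+-cong (ΣWalks-∷ l stay (firstReturnᵇ 0)) (ΣWalks-∷ l up (firstReturnᵇ 1)))
    where
    down-last : ∀ l → ΣWalks l (λ ss → weightIf (firstReturnᵇ 0 (down ∷ ss)) (down ∷ ss)) ≈ A * one l
    down-last zero    = sym (*-identityʳ A)
    down-last (suc l) = trans (ΣWalks-zero (suc l)) (sym (zeroʳ A))
  FirstRet-suc (suc d) l =
    +-cong (ΣWalks-∷ l down (firstReturnᵇ d))
           (+-cong (ΣWalks-∷ l stay (firstReturnᵇ (suc d))) (ΣWalks-∷ l up (firstReturnᵇ (suc (suc d)))))

  Prim-suc : ∀ l → Prim (suc l) ≈ step 0# (one l) (FirstRet 0 l)
  Prim-suc l = +-cong (trans (ΣWalks-zero l) (sym (zeroʳ A))) (+-cong (stay-last l) (ΣWalks-∷ l up (firstReturnᵇ 0)))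
    where
    stay-last : ∀ l → ΣWalks l (λ ss → weightIf (primitiveᵇ (stay ∷ ss)) (stay ∷ ss)) ≈ B * one l
    stay-last zero    = sym (*-identityʳ B)
    stay-last (suc l) = trans (ΣWalks-zero (suc l)) (sym (zeroʳ B))

  -- Last-step decomposition: a first return to 0 is a return to height 1 followed by a down step.
  FirstRet-suc≈Ret*A : ∀ l d → FirstRet d (suc l) ≈ Ret d l * A
  FirstRet-suc≈Ret*A zero zero    = trans (+-cong refl (+-identityʳ 0#)) (trans (+-identityʳ A) (sym (*-identityˡ A)))
  FirstRet-suc≈Ret*A zero (suc d) = trans (+-cong refl (+-identityʳ 0#)) (trans (+-identityʳ 0#) (sym (zeroˡ A)))
  FirstRet-suc≈Ret*A (suc l) d = begin
    FirstRet d (suc (suc l))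
      ≈⟨ FirstRet-suc d (suc l) ⟩
    step (FirstRet↓ d (suc l)) (FirstRet d (suc l)) (FirstRet (suc d) (suc l))
      ≈⟨ step-cong (below d) (FirstRet-suc≈Ret*A l d) (FirstRet-suc≈Ret*A l (suc d)) ⟩
    step (Ret↓ d l * A) (Ret d l * A) (Ret (suc d) l * A)
      ≈⟨ sym (step-*ʳ _ _ _ A) ⟩
    step (Ret↓ d l) (Ret d l) (Ret (suc d) l) * A
      ≈⟨ *-cong (sym (Ret-suc d l)) refl ⟩
    Ret d (suc l) * A
      ∎
    where
    below : ∀ d → FirstRet↓ d (suc l) ≈ Ret↓ d l * A
    below zero    = sym (zeroˡ A)
    below (suc d) = FirstRet-suc≈Ret*A l d

  -- First-passage decomposition: cut a return from height d + 1 at its first visit to 0.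
  Ret-suc≈FirstRet⊛Ret0 : ∀ l d → Ret (suc d) l ≈ (FirstRet d ⊛ Ret 0) l
  Ret-suc≈FirstRet⊛Ret0 zero    d = sym (zeroˡ 1#)
  Ret-suc≈FirstRet⊛Ret0 (suc l) d = begin
    Ret (suc d) (suc l)
      ≈⟨ Ret-suc (suc d) l ⟩
    step (Ret d l) (Ret (suc d) l) (Ret (suc (suc d)) l)
      ≈⟨ step-cong (below d) (Ret-suc≈FirstRet⊛Ret0 l d) (Ret-suc≈FirstRet⊛Ret0 l (suc d)) ⟩
    step ((FirstRet↓ d ⊛ Ret 0) l) ((FirstRet d ⊛ Ret 0) l) ((FirstRet (suc d) ⊛ Ret 0) l)
      ≈⟨ sym (step-⊛ l _ _ _ (Ret 0)) ⟩
    ((λ j → step (FirstRet↓ d j) (FirstRet d j) (FirstRet (suc d) j)) ⊛ Ret 0) l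
      ≈⟨ ⊛-congˡ l (Ret 0) (λ j → sym (FirstRet-suc d j)) ⟩
    ((FirstRet d ∘ suc) ⊛ Ret 0) l
      ≈⟨ sym (⊛-sucˡ l (FirstRet d) (Ret 0) refl) ⟩
    (FirstRet d ⊛ Ret 0) (suc l)
      ∎
    where
    below : ∀ d → Ret d l ≈ (FirstRet↓ d ⊛ Ret 0) l
    below zero    = sym (one-⊛ l (Ret 0))
    below (suc d) = Ret-suc≈FirstRet⊛Ret0 l d

  Ret0≈1+Prim⊛Ret0 : ∀ n → Ret 0 n ≈ one n + (Prim ⊛ Ret 0) n
  Ret0≈1+Prim⊛Ret0 zero    = sym (trans (+-cong refl (zeroˡ 1#)) (+-identityʳ 1#))
  Ret0≈1+Prim⊛Ret0 (suc l) = begin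
    Ret 0 (suc l)
      ≈⟨ Ret-suc 0 l ⟩
    step 0# (Ret 0 l) (Ret 1 l)
      ≈⟨ step-cong (sym (⊛-zeroˡ l (Ret 0))) (sym (one-⊛ l (Ret 0))) (Ret-suc≈FirstRet⊛Ret0 l 0) ⟩
    step (((λ _ → 0#) ⊛ Ret 0) l) ((one ⊛ Ret 0) l) ((FirstRet 0 ⊛ Ret 0) l)
      ≈⟨ sym (step-⊛ l _ _ _ (Ret 0)) ⟩
    ((λ j → step 0# (one j) (FirstRet 0 j)) ⊛ Ret 0) l
      ≈⟨ ⊛-congˡ l (Ret 0) (λ j → sym (Prim-suc j)) ⟩
    ((Prim ∘ suc) ⊛ Ret 0) l
      ≈⟨ sym (⊛-sucˡ l Prim (Ret 0) refl) ⟩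
    (Prim ⊛ Ret 0) (suc l)
      ≈⟨ sym (+-identityˡ _) ⟩
    one (suc l) + (Prim ⊛ Ret 0) (suc l)
      ∎

  G≈1+H⊛G : ∀ n → G n ≈ one n + (H ⊛ G) n
  G≈1+H⊛G n = begin
    G n                             ≈⟨ G≋Ret0 n ⟩
    Ret 0 n                         ≈⟨ Ret0≈1+Prim⊛Ret0 n ⟩
    one n + (Prim ⊛ Ret 0) n        ≈⟨ +-cong refl (⊛-congˡ n (Ret 0) (sym ∘ H≋Prim)) ⟩
    one n + (H ⊛ Ret 0) n           ≈⟨ +-cong refl (⊛-congʳ n H (sym ∘ G≋Ret0)) ⟩
    one n + (H ⊛ G) n               ∎

  H≋Bz+CGAz² : H ≋ ((const B ⊛ Z) ⊕ (((const C ⊛ G) ⊛ const A) ⊛ (Z ⊛ Z)))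
  H≋Bz+CGAz² n = trans (H≋Prim n) (Prim≋Bz+CGAz² n)
    where
    CGA : PowerSeries
    CGA = (const C ⊛ G) ⊛ const A

    CGA≈C*FirstRet0 : ∀ m → CGA m ≈ C * FirstRet 0 (suc m)
    CGA≈C*FirstRet0 m = begin
      CGA m                      ≈⟨ ⊛-const m (const C ⊛ G) A ⟩
      (const C ⊛ G) m * A        ≈⟨ *-cong (const-⊛ m C G) refl ⟩
      (C * G m) * A              ≈⟨ *-assoc C (G m) A ⟩
      C * (G m * A)              ≈⟨ *-cong refl (*-cong (G≋Ret0 m) refl) ⟩
      C * (Ret 0 m * A)          ≈⟨ *-cong refl (sym (FirstRet-suc≈Ret*A m 0)) ⟩
      C * FirstRet 0 (suc m)     ∎

    Prim≋Bz+CGAz² : Prim ≋ ((const B ⊛ Z) ⊕ (CGA ⊛ (Z ⊛ Z)))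
    Prim≋Bz+CGAz² zero = sym (trans (+-cong (zeroʳ B) (⊛-Z²-zero CGA)) (+-identityʳ 0#))
    Prim≋Bz+CGAz² (suc zero) = begin
      Prim 1                             ≈⟨ Prim-suc 0 ⟩
      step 0# 1# 0#                      ≈⟨ +-cong (zeroʳ A) (+-cong (*-identityʳ B) (zeroʳ C)) ⟩
      0# + (B + 0#)                      ≈⟨ +-identityˡ _ ⟩
      B + 0#                             ≈⟨ +-cong (sym (trans (const-⊛ 1 B Z) (*-identityʳ B)))
                                                   (sym (trans (⊛-Z²-suc 0 CGA) (⊛-Z-zero CGA))) ⟩
      (const B ⊛ Z) 1 + (CGA ⊛ (Z ⊛ Z)) 1  ∎
    Prim≋Bz+CGAz² (suc (suc m)) = begin
      Prim (suc (suc m))                             ≈⟨ Prim-suc (suc m) ⟩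
      step 0# 0# (FirstRet 0 (suc m))                ≈⟨ +-cong (zeroʳ A) (+-cong (zeroʳ B) refl) ⟩
      0# + (0# + C * FirstRet 0 (suc m))             ≈⟨ +-cong (sym (zeroʳ B)) (+-identityˡ _) ⟩
      B * 0# + C * FirstRet 0 (suc m)                ≈⟨ +-cong (sym (const-⊛ (suc (suc m)) B Z)) (sym (CGA≈C*FirstRet0 m)) ⟩
      (const B ⊛ Z) (suc (suc m)) + CGA m            ≈⟨ +-cong refl (sym (trans (⊛-Z²-suc (suc m) CGA) (⊛-Z-suc m CGA))) ⟩
      (const B ⊛ Z) (suc (suc m)) + (CGA ⊛ (Z ⊛ Z)) (suc (suc m))  ∎

lemma2p7 : ∀ {c ℓ} (R : Ring c ℓ) (A B C : Ring.Carrier R) →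
    let open Ring R
        open Series R
        open Walks A B C
    in ((N n : ℕ) → n ≤ N → G n ≈ geomPartial H N n)
       × (H ≋ ((const B ⊛ Z) ⊕ (((const C ⊛ G) ⊛ const A) ⊛ (Z ⊛ Z))))
lemma2p7 R A B C =
  SeriesProperties.fixedPoint≈geomPartial R H G (H≋Prim 0) G≈1+H⊛G , H≋Bz+CGAz²
  where
  open Series.Walks R A B C using (G; H)
  open WalkSeries R A B C
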